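{- If a graph $G$ is niche-realizable, then each component of the complement $\overline{G}$ has diameter at most two.
   Context: All graphs are simple. A bipartite tournament is an orientation of a complete bipartite graph. The niche graph of a digraph $D$ is the graph with vertex set $V(D)$ in which distinct $u,v$ are adjacent iff there is a vertex $w$ with $(u,w),(v,w)\in A(D)$, or with $(w,u),(w,v)\in A(D)$. A graph is niche-realizable if it is the niche graph of some bipartite tournament. -}

module Defs where

open import Data.Nat using (ℕ)
open import Data.Fin using (Fin)
open import Data.Bool using (Bool)
open import Data.Product using (Σ; ∃; ∃-syntax; _×_; _,_)
open import Data.Sum using (_⊎_)
open import Data.Empty using (⊥)
open import Relation.Nullary using (¬_)
open import Relation.Binary.PropositionalEquality using (_≡_; _≢_)

record Graph (n : ℕ) : Set₁ where
  field
    Adj   : Fin n → Fin n → Set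
    sym   : ∀ {u v} → Adj u v → Adj v u
    irrefl : ∀ {u} → ¬ Adj u u
open Graph public

Digraph : ℕ → Set₁
Digraph n = Fin n → Fin n → Set

record IsBipartiteTournament {n : ℕ} (D : Digraph n) : Set where
  field
    side     : Fin n → Bool
    noInside : ∀ u v → D u v → side u ≢ side v
    complete : ∀ u v → side u ≢ side v → D u v ⊎ D v u
    oriented : ∀ u v → D u v → ¬ D v u

NicheAdj : ∀ {n} → Digraph n → Fin n → Fin n → Set
NicheAdj D u v =
  u ≢ v × (∃[ w ] (D u w × D v w) ⊎ ∃[ w ] (D w u × D w v))

IsNicheGraphOf : ∀ {n} → Graph n → Digraph n → Set
IsNicheGraphOf G D = ∀ u v → (Adj G u v → NicheAdj D u v) × (NicheAdj D u v → Adj G u v)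

NicheRealizable : ∀ {n} → Graph n → Set₁
NicheRealizable {n} G = Σ (Digraph n) λ D → IsBipartiteTournament D × IsNicheGraphOf G D

CoAdj : ∀ {n} → Graph n → Fin n → Fin n → Set
CoAdj G u v = u ≢ v × ¬ Adj G u v

data Connected {n : ℕ} (R : Fin n → Fin n → Set) : Fin n → Fin n → Set where
  here : ∀ {u} → Connected R u u
  step : ∀ {u v w} → R u v → Connected R v w → Connected R u w

DistAtMost2 : ∀ {n} → (Fin n → Fin n → Set) → Fin n → Fin n → Set
DistAtMost2 R u v = u ≡ v ⊎ R u v ⊎ ∃[ w ] (R u w × R w v)

ComponentsDiamAtMost2 : ∀ {n} → (Fin n → Fin n → Set) → Set
ComponentsDiamAtMost2 R = ∀ u v → Connected R u v → DistAtMost2 R u v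

module Submission where

open import Data.Nat using (ℕ)
open import Data.Bool using (Bool)
open import Data.Bool.Properties using (¬-not) renaming (_≟_ to _≟ᵇ_)
open import Data.Empty using (⊥; ⊥-elim)
open import Data.Fin using (Fin; _≟_)
open import Data.Fin.Properties using (any?)
open import Data.Product using (∃-syntax; _×_; _,_; proj₁; proj₂)
open import Data.Sum using (_⊎_; inj₁; inj₂)
open import Relation.Nullary using (¬_; yes; no)
open import Relation.Nullary.Decidable using (¬?)
open import Relation.Binary.PropositionalEquality
  using (_≡_; _≢_; cong; sym; trans; ≢-sym)
open import Defs hiding (sym)

-- In a bipartite digraph two vertices with a common out- or in-neighbour lie on the same
-- side, so every edge of the niche graph lies inside a side. Hence vertices on different
-- sides are adjacent in the complement, and vertices on the same side are joined there
-- through any vertex of the other side; if the other side is empty there are no arcs,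
-- the niche graph is edgeless and its complement is complete. So the complement itself
-- has diameter at most two, using only the bipartition of the bipartite tournament.

module _ {n : ℕ} {D : Digraph n} {side : Fin n → Bool}
         (noInside : ∀ u v → D u v → side u ≢ side v) where

  commonHead⇒sameSide : ∀ {u v w} → D u w → D v w → side u ≡ side v
  commonHead⇒sameSide uw vw =
    trans (¬-not (noInside _ _ uw)) (sym (¬-not (noInside _ _ vw)))

  commonTail⇒sameSide : ∀ {u v w} → D w u → D w v → side u ≡ side v
  commonTail⇒sameSide wu wv =
    trans (¬-not (≢-sym (noInside _ _ wu))) (sym (¬-not (≢-sym (noInside _ _ wv))))

  nicheAdj⇒sameSide : ∀ {u v} → NicheAdj D u v → side u ≡ side v
  nicheAdj⇒sameSide (_ , inj₁ (_ , uw , vw)) = commonHead⇒sameSide uw vw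
  nicheAdj⇒sameSide (_ , inj₂ (_ , wu , wv)) = commonTail⇒sameSide wu wv

  oneSided⇒arcless : ∀ {b} → (∀ w → side w ≡ b) → ∀ x y → ¬ D x y
  oneSided⇒arcless all≡b x y xy = noInside x y xy (trans (all≡b x) (sym (all≡b y)))

module _ {n : ℕ} {G : Graph n} {D : Digraph n} (niche : IsNicheGraphOf G D) where

  adj⇒nicheAdj : ∀ {u v} → Adj G u v → NicheAdj D u v
  adj⇒nicheAdj {u} {v} = proj₁ (niche u v)

  arcless⇒coAdj : (∀ x y → ¬ D x y) → ∀ {u v} → u ≢ v → CoAdj G u v
  arcless⇒coAdj arcless u≢v = u≢v , λ uv → noCommonNeighbour (proj₂ (adj⇒nicheAdj uv))
    where
    noCommonNeighbour : ∀ {u v} → ∃[ w ] (D u w × D v w) ⊎ ∃[ w ] (D w u × D w v) → ⊥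
    noCommonNeighbour (inj₁ (w , uw , _)) = arcless _ w uw
    noCommonNeighbour (inj₂ (w , wu , _)) = arcless w _ wu

  module _ {side : Fin n → Bool} (noInside : ∀ u v → D u v → side u ≢ side v) where

    differentSides⇒coAdj : ∀ {u v} → side u ≢ side v → CoAdj G u v
    differentSides⇒coAdj sides≢ =
        (λ u≡v → sides≢ (cong side u≡v))
      , (λ uv → sides≢ (nicheAdj⇒sameSide noInside (adj⇒nicheAdj uv)))

    sameSide⇒coDistAtMost2 : ∀ {u v} → u ≢ v → side u ≡ side v → DistAtMost2 (CoAdj G) u v
    sameSide⇒coDistAtMost2 {u} u≢v sides≡ with any? (λ w → ¬? (side w ≟ᵇ side u))
    ... | yes (w , w≢u) = inj₂ (inj₂ (w , differentSides⇒coAdj (≢-sym w≢u)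
                                        , differentSides⇒coAdj (λ w≡v → w≢u (trans w≡v (sym sides≡)))))
    ... | no noneOpposite =
      inj₂ (inj₁ (arcless⇒coAdj (oneSided⇒arcless noInside allOnSideOfU) u≢v))
      where
      allOnSideOfU : ∀ w → side w ≡ side u
      allOnSideOfU w with side w ≟ᵇ side u
      ... | yes w≡u = w≡u
      ... | no  w≢u = ⊥-elim (noneOpposite (w , w≢u))

    coDistAtMost2 : ∀ u v → DistAtMost2 (CoAdj G) u v
    coDistAtMost2 u v with u ≟ v | side u ≟ᵇ side v
    ... | yes u≡v | _         = inj₁ u≡v
    ... | no  u≢v | yes sides≡ = sameSide⇒coDistAtMost2 u≢v sides≡
    ... | no  _   | no  sides≢ = inj₂ (inj₁ (differentSides⇒coAdj sides≢))

proposition2p15 : (n : ℕ) (G : Graph n) → NicheRealizable G →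
    ComponentsDiamAtMost2 (CoAdj G)
proposition2p15 n G (D , bt , niche) u v _ =
  coDistAtMost2 {G = G} niche (IsBipartiteTournament.noInside bt) u v
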